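{- If $G$ is a connected graph, then $\mathrm{id}^{\leq 3}(G) \leq \left\lceil \frac{3|E(G)|}{4}\right\rceil$.
   Context: All graphs are finite and simple. In an oriented graph, the inversion of a vertex set $X$ reverses the orientation of every arc with both endvertices in $X$; a $(\leq p)$-inversion is the inversion of a set of at most $p$ vertices. For a graph $G$ with labelled vertices, $\mathrm{id}^{\leq p}(G)$ (the $(\leq p)$-inversion diameter) is the maximum, over all pairs of orientations $\vec G_1,\vec G_2$ of $G$, of the minimum number of $(\leq p)$-inversions whose successive application transforms $\vec G_1$ into $\vec G_2$. -}

module Defs where

open import Data.Nat using (ℕ; zero; suc; _+_; _*_; _≤_; _<_)
open import Data.Nat.DivMod using (_/_)
open import Data.Bool using (Bool; true; false; _∧_; not; if_then_else_)
open import Data.Fin using (Fin; toℕ)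
open import Data.Fin.Subset using (Subset; _∈_; ∣_∣)
open import Data.List using (List; []; _∷_; length; foldl)
open import Data.List.Relation.Unary.All using (All)
open import Data.Vec using (lookup)
open import Data.Product using (Σ; _×_; _,_)
open import Data.Sum using (_⊎_)
open import Relation.Nullary using (¬_)
open import Relation.Binary.PropositionalEquality using (_≡_)

record Graph (n : ℕ) : Set where
  field
    adj     : Fin n → Fin n → Bool
    irrefl  : ∀ i → adj i i ≡ false
    sym     : ∀ i j → adj i j ≡ adj j i
open Graph public

countFin : ∀ {n} → (Fin n → ℕ) → ℕ
countFin {zero}  f = 0
countFin {suc n} f = f Data.Fin.zero + countFin (λ i → f (Data.Fin.suc i))

edgeCount : ∀ {n} → Graph n → ℕ
edgeCount {n} G =
  countFin (λ i → countFin (λ j →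
    if adj G i j ∧ isLess i j then 1 else 0))
  where
  isLess : Fin n → Fin n → Bool
  isLess i j with toℕ i Data.Nat.<? toℕ j
  ... | Relation.Nullary.yes _ = true
  ... | Relation.Nullary.no _  = false

data Walk {n : ℕ} (G : Graph n) : Fin n → Fin n → Set where
  here : ∀ {u} → Walk G u u
  step : ∀ {u v w} → adj G u v ≡ true → Walk G v w → Walk G u w

Connected : ∀ {n} → Graph n → Set
Connected G = ∀ u v → Walk G u v

-- An orientation of G: arc i j = true means the arc goes from i to j.
-- Each edge gets exactly one direction, non-edges get no arc.
record Orientation {n : ℕ} (G : Graph n) : Set where
  field
    arc      : Fin n → Fin n → Bool
    on-edges : ∀ i j → adj G i j ≡ true →
               (arc i j ≡ true × arc j i ≡ false) ⊎ (arc i j ≡ false × arc j i ≡ true)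
    off-edges : ∀ i j → adj G i j ≡ false → arc i j ≡ false
open Orientation public

inSet : ∀ {n} → Subset n → Fin n → Bool
inSet X i = lookup X i

invert : ∀ {n} → Subset n → (Fin n → Fin n → Bool) → (Fin n → Fin n → Bool)
invert X a i j = if inSet X i ∧ inSet X j then a j i else a i j

invertAll : ∀ {n} → List (Subset n) → (Fin n → Fin n → Bool) → (Fin n → Fin n → Bool)
invertAll Xs a = foldl (λ b X → invert X b) a Xs

-- id^{≤p}(G) ≤ k : for every pair of orientations O1, O2 of G there is a
-- sequence of at most k (≤ p)-inversions transforming O1 into O2.
InvDiamAtMost : ∀ {n} → ℕ → Graph n → ℕ → Set
InvDiamAtMost {n} p G k =
  (O₁ O₂ : Orientation G) →
  Σ (List (Subset n)) λ Xs →
    length Xs ≤ k ×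
    All (λ X → ∣ X ∣ ≤ p) Xs ×
    (∀ i j → invertAll Xs (arc O₁) i j ≡ arc O₂ i j)

⌈_/_⌉ : ℕ → (d : ℕ) → .{{_ : Data.Nat.NonZero d}} → ℕ
⌈ m / suc d ⌉ = (m + d) / suc d

{-# OPTIONS --safe #-}

-- Two orientations of G differ on a symmetric set D of edges, and a list of inversions turns one
-- into the other exactly when the edges lying in an odd number of the inverted sets are those of D.
-- Vertices are eliminated one at a time. If v has even degree 2h among the remaining vertices,
-- pair up the neighbours x of v with vx ∈ D and invert each triple {v, x, y}: at most h inversions
-- settle every edge at v, and the side effect on xy is added to the demand on the remaining graph.
-- If v has odd degree, a neighbour a of v is eliminated first, with at most ⌈deg a / 2⌉
-- inversions, after which v has even degree. Either way the number of inversions is at most a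
-- quarter of the decrease of 2|E| + |V|, so at most (2m + n)/4 inversions are used; connectivity
-- gives n ≤ m + 1, hence at most (3m + 1)/4 ≤ ⌈3m/4⌉.
module Submission where

open import Defs hiding (sym)
open import Data.Nat.Properties
  using ( +-0-commutativeMonoid; +-commutativeSemigroup; module ≤-Reasoning
        ; +-comm; +-suc; +-identityʳ; *-comm; *-suc; *-distribˡ-+; suc-injective
        ; ≤-refl; ≤-reflexive; ≤-trans; n≤1+n; m≤n⇒m≤1+n; m≤m+n; m≤n+m; <-cmp; <-asym
        ; +-mono-≤; +-monoˡ-≤; +-monoʳ-≤; *-monoʳ-≤; *-cancelˡ-≤
        ; ⌈n/2⌉-mono; ⌊n/2⌋≤⌈n/2⌉; ⌊n/2⌋+⌈n/2⌉≡n; n≡⌈n+n/2⌉ )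
open import Algebra.Properties.CommutativeMonoid.Sum +-0-commutativeMonoid
  using (sum; sum-cong-≗; sum-replicate-zero; ∑-distrib-+; ∑-comm)
open import Algebra.Properties.CommutativeSemigroup +-commutativeSemigroup using (x∙yz≈y∙xz)
open import Data.Bool using (Bool; true; false; _∧_; _∨_; not; _xor_; if_then_else_)
open import Data.Bool.Properties
  using ( not-injective; ∨-zeroʳ; ∧-comm; ∧-identityʳ; ∧-zeroʳ; ∧-conicalˡ; ∧-conicalʳ
        ; xor-assoc; xor-comm; xor-same; xor-identityʳ )
  renaming (_≟_ to _≟ᵇ_)
open import Data.Empty using (⊥-elim)
open import Data.Fin using (Fin; zero; suc; toℕ)
open import Data.Fin.Properties using (_≟_; any?; toℕ-injective)
open import Data.Fin.Subset using (Subset; ∣_∣)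
open import Data.List using (List; []; _∷_; _++_; length; map)
open import Data.List.Properties using (length-map; length-++)
open import Data.List.Relation.Unary.All as All using (All; []; _∷_)
open import Data.List.Relation.Unary.All.Properties using (map⁺; ++⁺)
open import Data.Nat using (ℕ; zero; suc; _+_; _*_; _≤_; _<_; _<?_; z≤n; s≤s; s≤s⁻¹; ⌊_/2⌋; ⌈_/2⌉)
open import Data.Nat.DivMod using (_/_; m*n/n≡m; /-monoˡ-≤)
open import Data.Nat.Tactic.RingSolver using (solve-∀)
open import Data.Product using (Σ; ∃; _×_; _,_; proj₁; proj₂)
open import Data.Sum using (_⊎_; inj₁; inj₂)
open import Data.Vec using (tabulate)
open import Data.Vec.Properties using (lookup∘tabulate)
open import Function using (_∘_)
open import Relation.Binary using (tri<; tri≈; tri>)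
open import Relation.Binary.PropositionalEquality
open import Relation.Nullary using (¬_; does; yes; no)
open import Relation.Nullary.Decidable using (dec-true; dec-false)

-- Finite sums

⟦_⟧ : Bool → ℕ
⟦ b ⟧ = if b then 1 else 0

_≡ᵇ_ : ∀ {n} → Fin n → Fin n → Bool
i ≡ᵇ j = does (i ≟ j)

≡ᵇ-refl : ∀ {n} (i : Fin n) → (i ≡ᵇ i) ≡ true
≡ᵇ-refl i = dec-true (i ≟ i) refl

≡ᵇ-false : ∀ {n} {i j : Fin n} → i ≢ j → (i ≡ᵇ j) ≡ false
≡ᵇ-false {i = i} {j} = dec-false (i ≟ j)

countFin≡sum : ∀ {n} (f : Fin n → ℕ) → countFin f ≡ sum f
countFin≡sum {zero}  f = refl
countFin≡sum {suc n} f = cong (f zero +_) (countFin≡sum (f ∘ suc))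

sum-mono-≤ : ∀ {n} {f g : Fin n → ℕ} → (∀ i → f i ≤ g i) → sum f ≤ sum g
sum-mono-≤ {zero}  f≤g = z≤n
sum-mono-≤ {suc n} f≤g = +-mono-≤ (f≤g zero) (sum-mono-≤ (f≤g ∘ suc))

sum-positive : ∀ {n} (f : Fin n → ℕ) → 0 < sum f → ∃ λ i → 0 < f i
sum-positive {suc n} f 0<∑f with f zero in f₀
... | suc _ = zero , subst (0 <_) (sym f₀) (s≤s z≤n)
... | zero  with i , 0<fi ← sum-positive (f ∘ suc) 0<∑f = suc i , 0<fi

sum-pick : ∀ {n} (v : Fin n) (f : Fin n → ℕ) →
           sum f ≡ f v + sum (λ i → if i ≡ᵇ v then 0 else f i)
sum-pick zero    f = refl
sum-pick (suc v) f = begin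
  f zero + sum (f ∘ suc)                                              ≡⟨ cong (f zero +_) (sum-pick v (f ∘ suc)) ⟩
  f zero + (f (suc v) + sum (λ i → if i ≡ᵇ v then 0 else f (suc i)))  ≡⟨ x∙yz≈y∙xz (f zero) (f (suc v)) _ ⟩
  f (suc v) + (f zero + sum (λ i → if i ≡ᵇ v then 0 else f (suc i)))  ∎
  where open ≡-Reasoning

sum-⟦≡ᵇ⟧ : ∀ {n} (v : Fin n) → sum (λ i → ⟦ i ≡ᵇ v ⟧) ≡ 1
sum-⟦≡ᵇ⟧ {n} v = begin
  sum (λ i → ⟦ i ≡ᵇ v ⟧)                                    ≡⟨ sum-pick v _ ⟩
  ⟦ v ≡ᵇ v ⟧ + sum (λ i → if i ≡ᵇ v then 0 else ⟦ i ≡ᵇ v ⟧)  ≡⟨ cong₂ _+_ (cong ⟦_⟧ (≡ᵇ-refl v)) (sum-cong-≗ (vanish ∘ (_≡ᵇ v))) ⟩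
  1 + sum {n} (λ _ → 0)                                     ≡⟨ cong suc (sum-replicate-zero n) ⟩
  1                                                         ∎
  where
  open ≡-Reasoning
  vanish : ∀ b → (if b then 0 else ⟦ b ⟧) ≡ 0
  vanish true  = refl
  vanish false = refl

∣tabulate∣≡sum : ∀ {n} (f : Fin n → Bool) → ∣ tabulate f ∣ ≡ sum (⟦_⟧ ∘ f)
∣tabulate∣≡sum {zero}  f = refl
∣tabulate∣≡sum {suc n} f with f zero
... | true  = cong suc (∣tabulate∣≡sum (f ∘ suc))
... | false = ∣tabulate∣≡sum (f ∘ suc)

module _ {n : ℕ} where

  full : Fin n → Bool
  full _ = true

  _∖_ : (Fin n → Bool) → Fin n → Fin n → Bool
  (L ∖ v) i = not (i ≡ᵇ v) ∧ L i

  add : Fin n → (Fin n → Bool) → Fin n → Bool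
  add y S i = (i ≡ᵇ y) ∨ S i

  ∖-keeps : ∀ (L : Fin n → Bool) {v i} → L i ≡ true → i ≢ v → (L ∖ v) i ≡ true
  ∖-keeps L Li i≢v rewrite ≡ᵇ-false i≢v = Li

  ∖-outside : ∀ (L : Fin n → Bool) {v i} → L i ≡ false → (L ∖ v) i ≡ false
  ∖-outside L {v} {i} Li rewrite Li = ∧-zeroʳ (not (i ≡ᵇ v))

  ∖-removes : ∀ (L : Fin n → Bool) v → (L ∖ v) v ≡ false
  ∖-removes L v rewrite ≡ᵇ-refl v = refl

  add-keeps : ∀ {S : Fin n → Bool} y {i} → S i ≡ true → add y S i ≡ true
  add-keeps {S} y {i} Si = trans (cong ((i ≡ᵇ y) ∨_) Si) (∨-zeroʳ (i ≡ᵇ y))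

  sumOver : (Fin n → Bool) → (Fin n → ℕ) → ℕ
  sumOver L f = sum (λ i → if L i then f i else 0)

  sumOver-cong : ∀ {L L′ : Fin n → Bool} {f g : Fin n → ℕ} →
                 (∀ i → L i ≡ L′ i) → (∀ i → f i ≡ g i) → sumOver L f ≡ sumOver L′ g
  sumOver-cong L≗L′ f≗g = sum-cong-≗ (λ i → cong₂ (λ b x → if b then x else 0) (L≗L′ i) (f≗g i))

  sumOver-+ : ∀ L (f g : Fin n → ℕ) → sumOver L (λ i → f i + g i) ≡ sumOver L f + sumOver L g
  sumOver-+ L f g = trans (sum-cong-≗ split) (∑-distrib-+ (λ i → if L i then f i else 0) (λ i → if L i then g i else 0))
    where
    split : ∀ i → (if L i then f i + g i else 0) ≡ (if L i then f i else 0) + (if L i then g i else 0)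
    split i with L i
    ... | true  = refl
    ... | false = refl

  sumOver-∖ : ∀ L v (f : Fin n → ℕ) → sumOver L f ≡ (if L v then f v else 0) + sumOver (L ∖ v) f
  sumOver-∖ L v f = trans (sum-pick v _) (cong ((if L v then f v else 0) +_) (sum-cong-≗ skip-v))
    where
    skip-v : ∀ i → (if i ≡ᵇ v then 0 else (if L i then f i else 0)) ≡ (if (L ∖ v) i then f i else 0)
    skip-v i with i ≡ᵇ v
    ... | true  = refl
    ... | false = refl

  sumOver-∈ : ∀ L {v} (f : Fin n → ℕ) → L v ≡ true → sumOver L f ≡ f v + sumOver (L ∖ v) f
  sumOver-∈ L {v} f Lv = trans (sumOver-∖ L v f) (cong (λ b → (if b then f v else 0) + sumOver (L ∖ v) f) Lv)

  sumOver-witness : ∀ L (f : Fin n → ℕ) → 0 < sumOver L f → ∃ λ i → L i ≡ true × 0 < f i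
  sumOver-witness L f 0<∑ with i , 0<term ← sum-positive _ 0<∑ with L i in Li
  ... | true = i , Li , 0<term

-- Inversions and orientations

xor-cancel : ∀ a b → a xor (b xor a) ≡ b
xor-cancel a b = begin
  a xor (b xor a)  ≡⟨ cong (a xor_) (xor-comm b a) ⟩
  a xor (a xor b)  ≡⟨ xor-assoc a a b ⟨
  (a xor a) xor b  ≡⟨ cong (_xor b) (xor-same a) ⟩
  b                ∎
  where open ≡-Reasoning

module _ {n : ℕ} where

  flips : List (Subset n) → Fin n → Fin n → Bool
  flips []       i j = false
  flips (X ∷ Xs) i j = (inSet X i ∧ inSet X j) xor flips Xs i j

  flips-sym : ∀ Xs (i j : Fin n) → flips Xs i j ≡ flips Xs j i
  flips-sym []       i j = refl
  flips-sym (X ∷ Xs) i j = cong₂ _xor_ (∧-comm (inSet X i) (inSet X j)) (flips-sym Xs i j)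

  flips-++ : ∀ Xs Ys (i j : Fin n) → flips (Xs ++ Ys) i j ≡ flips Xs i j xor flips Ys i j
  flips-++ []       Ys i j = refl
  flips-++ (X ∷ Xs) Ys i j =
    trans (cong ((inSet X i ∧ inSet X j) xor_) (flips-++ Xs Ys i j)) (sym (xor-assoc (inSet X i ∧ inSet X j) _ _))

  flips-outside : ∀ {Xs} {i : Fin n} j → All (λ X → inSet X i ≡ false) Xs → flips Xs i j ≡ false
  flips-outside j []           = refl
  flips-outside j (i∉X ∷ i∉Xs) rewrite i∉X = flips-outside j i∉Xs

  invertAll≡flipIf : ∀ Xs (a : Fin n → Fin n → Bool) i j →
                     invertAll Xs a i j ≡ (if flips Xs i j then a j i else a i j)
  invertAll≡flipIf []       a i j = refl
  invertAll≡flipIf (X ∷ Xs) a i j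
    rewrite invertAll≡flipIf Xs (invert X a) i j
    with inSet X i | inSet X j | flips Xs i j
  ... | true  | true  | true  = refl
  ... | true  | true  | false = refl
  ... | true  | false | _     = refl
  ... | false | true  | _     = refl
  ... | false | false | _     = refl

module _ {n : ℕ} {G : Graph n} where

  arc-reverse : (O : Orientation G) {i j : Fin n} → adj G i j ≡ true → arc O j i ≡ not (arc O i j)
  arc-reverse O {i} {j} e with on-edges O i j e
  ... | inj₁ (ij , ji) rewrite ij | ji = refl
  ... | inj₂ (ij , ji) rewrite ij | ji = refl

  arc-off : (O : Orientation G) {i j : Fin n} → adj G i j ≡ false → arc O j i ≡ false
  arc-off O {i} {j} e = off-edges O j i (trans (Graph.sym G j i) e)

  _△_ : Orientation G → Orientation G → Fin n → Fin n → Bool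
  (O₁ △ O₂) i j = arc O₁ i j xor arc O₂ i j

  △-sym : ∀ O₁ O₂ (i j : Fin n) → (O₁ △ O₂) i j ≡ (O₁ △ O₂) j i
  △-sym O₁ O₂ i j with adj G i j in e
  ... | true  rewrite arc-reverse O₁ e | arc-reverse O₂ e = xor-not² (arc O₁ i j) (arc O₂ i j)
    where
    xor-not² : ∀ x y → x xor y ≡ not x xor not y
    xor-not² true  true  = refl
    xor-not² true  false = refl
    xor-not² false true  = refl
    xor-not² false false = refl
  ... | false rewrite off-edges O₁ i j e | off-edges O₂ i j e | arc-off O₁ e | arc-off O₂ e = refl

  invertAll-△ : ∀ O₁ O₂ Xs → (∀ {i j} → adj G i j ≡ true → flips Xs i j ≡ (O₁ △ O₂) i j) →
                ∀ i j → invertAll Xs (arc O₁) i j ≡ arc O₂ i j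
  invertAll-△ O₁ O₂ Xs flips≡△ i j rewrite invertAll≡flipIf Xs (arc O₁) i j with adj G i j in e
  ... | true  rewrite flips≡△ e | arc-reverse O₁ e with arc O₁ i j | arc O₂ i j
  ...   | true  | true  = refl
  ...   | true  | false = refl
  ...   | false | true  = refl
  ...   | false | false = refl
  invertAll-△ O₁ O₂ Xs flips≡△ i j | false
    rewrite off-edges O₁ i j e | off-edges O₂ i j e | arc-off O₁ e with flips Xs i j
  ... | true  = refl
  ... | false = refl

-- Stars

members : ∀ {n} → (Fin n → Bool) → List (Fin n)
members {zero}  p = []
members {suc n} p = if p zero then zero ∷ later else later
  where later = map suc (members (p ∘ suc))

members-sound : ∀ {n} (p : Fin n → Bool) → All (λ x → p x ≡ true) (members p)
members-sound {zero}  p = []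
members-sound {suc n} p with p zero in p₀
... | true  = p₀ ∷ map⁺ (members-sound (p ∘ suc))
... | false = map⁺ (members-sound (p ∘ suc))

length-members : ∀ {n} (p : Fin n → Bool) → length (members p) ≡ sum (⟦_⟧ ∘ p)
length-members {zero}  p = refl
length-members {suc n} p with p zero
... | true  = cong suc (trans (length-map suc (members (p ∘ suc))) (length-members (p ∘ suc)))
... | false = trans (length-map suc (members (p ∘ suc))) (length-members (p ∘ suc))

module _ {n : ℕ} where

  occursOdd : List (Fin n) → Fin n → Bool
  occursOdd []       j = false
  occursOdd (x ∷ xs) j = (j ≡ᵇ x) xor occursOdd xs j

  occursOdd-++ : ∀ xs ys (j : Fin n) → occursOdd (xs ++ ys) j ≡ occursOdd xs j xor occursOdd ys j
  occursOdd-++ []       ys j = refl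
  occursOdd-++ (x ∷ xs) ys j =
    trans (cong ((j ≡ᵇ x) xor_) (occursOdd-++ xs ys j)) (sym (xor-assoc (j ≡ᵇ x) _ _))

  occursOdd-∉ : ∀ {j : Fin n} {xs} → All (j ≢_) xs → occursOdd xs j ≡ false
  occursOdd-∉ []           = refl
  occursOdd-∉ (j≢x ∷ j∉xs) rewrite ≡ᵇ-false j≢x = occursOdd-∉ j∉xs

occursOdd-map-suc : ∀ {n} (xs : List (Fin n)) j → occursOdd (map suc xs) (suc j) ≡ occursOdd xs j
occursOdd-map-suc []       j = refl
occursOdd-map-suc (x ∷ xs) j = cong ((j ≡ᵇ x) xor_) (occursOdd-map-suc xs j)

occursOdd-map-suc-zero : ∀ {n} (xs : List (Fin n)) → occursOdd (map suc xs) zero ≡ false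
occursOdd-map-suc-zero []       = refl
occursOdd-map-suc-zero (x ∷ xs) = occursOdd-map-suc-zero xs

occursOdd-members : ∀ {n} (p : Fin n → Bool) j → occursOdd (members p) j ≡ p j
occursOdd-members {suc n} p j with p zero in p₀
occursOdd-members {suc n} p zero    | true  rewrite occursOdd-map-suc-zero (members (p ∘ suc)) = sym p₀
occursOdd-members {suc n} p (suc j) | true  rewrite occursOdd-map-suc (members (p ∘ suc)) j = occursOdd-members (p ∘ suc) j
occursOdd-members {suc n} p zero    | false = trans (occursOdd-map-suc-zero (members (p ∘ suc))) (sym p₀)
occursOdd-members {suc n} p (suc j) | false = trans (occursOdd-map-suc (members (p ∘ suc)) j) (occursOdd-members (p ∘ suc) j)

module _ {n : ℕ} where

  -- Membership by parity of occurrences, so that no distinctness of the listed vertices is needed.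
  oddSet : List (Fin n) → Subset n
  oddSet xs = tabulate (occursOdd xs)

  inSet-oddSet : ∀ xs (j : Fin n) → inSet (oddSet xs) j ≡ occursOdd xs j
  inSet-oddSet xs = lookup∘tabulate (occursOdd xs)

  ∣oddSet∣≤length : ∀ xs → ∣ oddSet xs ∣ ≤ length xs
  ∣oddSet∣≤length xs = ≤-trans (≤-reflexive (∣tabulate∣≡sum (occursOdd xs))) (bound xs)
    where
    ⟦xor⟧≤ : ∀ a b → ⟦ a xor b ⟧ ≤ ⟦ a ⟧ + ⟦ b ⟧
    ⟦xor⟧≤ true  true  = z≤n
    ⟦xor⟧≤ true  false = ≤-refl
    ⟦xor⟧≤ false b     = ≤-refl
    bound : ∀ xs → sum (⟦_⟧ ∘ occursOdd xs) ≤ length xs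
    bound []       = ≤-reflexive (sum-replicate-zero n)
    bound (x ∷ xs) = begin
      sum (λ j → ⟦ (j ≡ᵇ x) xor occursOdd xs j ⟧)        ≤⟨ sum-mono-≤ (λ j → ⟦xor⟧≤ (j ≡ᵇ x) _) ⟩
      sum (λ j → ⟦ j ≡ᵇ x ⟧ + ⟦ occursOdd xs j ⟧)        ≡⟨ ∑-distrib-+ (λ j → ⟦ j ≡ᵇ x ⟧) _ ⟩
      sum (λ j → ⟦ j ≡ᵇ x ⟧) + sum (⟦_⟧ ∘ occursOdd xs)  ≤⟨ +-mono-≤ (≤-reflexive (sum-⟦≡ᵇ⟧ x)) (bound xs) ⟩
      suc (length xs)                                    ∎
      where open ≤-Reasoning

  pairWith : Fin n → List (Fin n) → List (Subset n)
  pairWith v []           = []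
  pairWith v (x ∷ [])     = oddSet (v ∷ x ∷ []) ∷ []
  pairWith v (x ∷ y ∷ xs) = oddSet (v ∷ x ∷ y ∷ []) ∷ pairWith v xs

  length-pairWith : ∀ v xs → length (pairWith v xs) ≡ ⌈ length xs /2⌉
  length-pairWith v []           = refl
  length-pairWith v (x ∷ [])     = refl
  length-pairWith v (x ∷ y ∷ xs) = cong suc (length-pairWith v xs)

  pairWith-small : ∀ v xs → All (λ X → ∣ X ∣ ≤ 3) (pairWith v xs)
  pairWith-small v []           = []
  pairWith-small v (x ∷ [])     = m≤n⇒m≤1+n (∣oddSet∣≤length (v ∷ x ∷ [])) ∷ []
  pairWith-small v (x ∷ y ∷ xs) = ∣oddSet∣≤length (v ∷ x ∷ y ∷ []) ∷ pairWith-small v xs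

  pairWith-outside : ∀ {i v : Fin n} {xs} → i ≢ v → All (i ≢_) xs →
                     All (λ X → inSet X i ≡ false) (pairWith v xs)
  pairWith-outside {i} {v} {[]}         i≢v []                 = []
  pairWith-outside {i} {v} {x ∷ []}     i≢v (i≢x ∷ [])         =
    trans (inSet-oddSet (v ∷ x ∷ []) i) (occursOdd-∉ (i≢v ∷ i≢x ∷ [])) ∷ []
  pairWith-outside {i} {v} {x ∷ y ∷ xs} i≢v (i≢x ∷ i≢y ∷ i∉xs) =
    trans (inSet-oddSet (v ∷ x ∷ y ∷ []) i) (occursOdd-∉ (i≢v ∷ i≢x ∷ i≢y ∷ []))
    ∷ pairWith-outside i≢v i∉xs

  flips-apex : ∀ {v j : Fin n} ys Xs → All (v ≢_) ys → j ≢ v →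
               flips (oddSet (v ∷ ys) ∷ Xs) v j ≡ occursOdd ys j xor flips Xs v j
  flips-apex {v} {j} ys Xs v∉ys j≢v
    rewrite inSet-oddSet (v ∷ ys) v | inSet-oddSet (v ∷ ys) j
          | ≡ᵇ-refl v | occursOdd-∉ v∉ys | ≡ᵇ-false j≢v = refl

  flips-pairWith : ∀ {v j : Fin n} xs → All (v ≢_) xs → j ≢ v → flips (pairWith v xs) v j ≡ occursOdd xs j
  flips-pairWith []           v∉xs j≢v = refl
  flips-pairWith (x ∷ [])     v∉xs j≢v = trans (flips-apex (x ∷ []) [] v∉xs j≢v) (xor-identityʳ _)
  flips-pairWith {v} {j} (x ∷ y ∷ xs) (v≢x ∷ v≢y ∷ v∉xs) j≢v = begin
    flips (pairWith v (x ∷ y ∷ xs)) v j                     ≡⟨ flips-apex (x ∷ y ∷ []) (pairWith v xs) (v≢x ∷ v≢y ∷ []) j≢v ⟩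
    occursOdd (x ∷ y ∷ []) j xor flips (pairWith v xs) v j  ≡⟨ cong (occursOdd (x ∷ y ∷ []) j xor_) (flips-pairWith xs v∉xs j≢v) ⟩
    occursOdd (x ∷ y ∷ []) j xor occursOdd xs j             ≡⟨ occursOdd-++ (x ∷ y ∷ []) xs j ⟨
    occursOdd (x ∷ y ∷ xs) j                                ∎
    where open ≡-Reasoning

even-or-odd : ∀ d → (∃ λ h → d ≡ h + h) ⊎ (∃ λ h → d ≡ suc (h + h))
even-or-odd zero    = inj₁ (0 , refl)
even-or-odd (suc d) with even-or-odd d
... | inj₁ (h , d≡h+h)   = inj₂ (h , cong suc d≡h+h)
... | inj₂ (h , d≡1+h+h) = inj₁ (suc h , cong suc (trans d≡1+h+h (sym (+-suc h h))))

4*n≡2*[n+n] : ∀ n → 4 * n ≡ 2 * (n + n)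
4*n≡2*[n+n] = solve-∀

4⌈n/2⌉≤2n+2 : ∀ n → 4 * ⌈ n /2⌉ ≤ 2 * n + 2
4⌈n/2⌉≤2n+2 n = begin
  4 * ⌈ n /2⌉                      ≡⟨ 4*n≡2*[n+n] ⌈ n /2⌉ ⟩
  2 * (⌈ n /2⌉ + ⌈ n /2⌉)          ≤⟨ *-monoʳ-≤ 2 (+-monoʳ-≤ ⌈ n /2⌉ (⌊n/2⌋≤⌈n/2⌉ (suc n))) ⟩
  2 * (⌊ suc n /2⌋ + ⌈ suc n /2⌉)  ≡⟨ cong (2 *_) (⌊n/2⌋+⌈n/2⌉≡n (suc n)) ⟩
  2 * suc n                        ≡⟨ *-suc 2 n ⟩
  2 + 2 * n                        ≡⟨ +-comm 2 (2 * n) ⟩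
  2 * n + 2                        ∎
  where open ≤-Reasoning

4⌈n+n/2⌉≡2[n+n] : ∀ n → 4 * ⌈ n + n /2⌉ ≡ 2 * (n + n)
4⌈n+n/2⌉≡2[n+n] n = trans (cong (4 *_) (sym (n≡⌈n+n/2⌉ n))) (4*n≡2*[n+n] n)

4*length-++ : ∀ {A : Set} (Xs Ys : List A) {a b} → 4 * length Xs ≤ a → 4 * length Ys ≤ b →
              4 * length (Xs ++ Ys) ≤ a + b
4*length-++ Xs Ys costXs costYs =
  ≤-trans (≤-reflexive (trans (cong (4 *_) (length-++ Xs)) (*-distribˡ-+ 4 (length Xs) (length Ys))))
          (+-mono-≤ costXs costYs)

≤⌈3m/4⌉ : ∀ {l s d m} → 4 * l ≤ d + s → 2 * s ≤ d + 2 → d ≡ 2 * m → l ≤ ⌈ 3 * m / 4 ⌉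
≤⌈3m/4⌉ {l} {s} {d} {m} cost size-bound refl = begin
  l                ≡⟨ m*n/n≡m l 4 ⟨
  l * 4 / 4        ≤⟨ /-monoˡ-≤ 4 (begin
    l * 4            ≡⟨ *-comm l 4 ⟩
    4 * l            ≤⟨ *-cancelˡ-≤ 2 doubled ⟩
    3 * m + 1        ≤⟨ +-monoʳ-≤ (3 * m) (s≤s z≤n) ⟩
    3 * m + 3        ∎) ⟩
  (3 * m + 3) / 4  ∎
  where
  open ≤-Reasoning
  doubled : 2 * (4 * l) ≤ 2 * (3 * m + 1)
  doubled = begin
    2 * (4 * l)                ≤⟨ *-monoʳ-≤ 2 cost ⟩
    2 * (2 * m + s)            ≡⟨ *-distribˡ-+ 2 (2 * m) s ⟩
    2 * (2 * m) + 2 * s        ≤⟨ +-monoʳ-≤ (2 * (2 * m)) size-bound ⟩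
    2 * (2 * m) + (2 * m + 2)  ≡⟨ regroup m ⟩
    2 * (3 * m + 1)            ∎
    where
    regroup : ∀ m → 2 * (2 * m) + (2 * m + 2) ≡ 2 * (3 * m + 1)
    regroup = solve-∀

-- Eliminating vertices

module _ {n : ℕ} (G : Graph n) where

  size : (Fin n → Bool) → ℕ
  size L = sumOver L (λ _ → 1)

  deg : (Fin n → Bool) → Fin n → ℕ
  deg L u = sumOver L (λ j → ⟦ adj G u j ⟧)

  degSum : (Fin n → Bool) → ℕ
  degSum L = sumOver L (deg L)

  potential : (Fin n → Bool) → ℕ
  potential L = degSum L + size L

  adj-irrefl : ∀ {u v} → adj G u v ≡ true → u ≢ v
  adj-irrefl {u} uv refl with () ← trans (sym uv) (irrefl G u)

  size-cong : ∀ {L L′} → (∀ i → L i ≡ L′ i) → size L ≡ size L′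
  size-cong L≗L′ = sumOver-cong L≗L′ (λ _ → refl)

  degSum-cong : ∀ {L L′} → (∀ i → L i ≡ L′ i) → degSum L ≡ degSum L′
  degSum-cong L≗L′ = sumOver-cong L≗L′ (λ _ → sumOver-cong L≗L′ (λ _ → refl))

  size-∈ : ∀ {L v} → L v ≡ true → size L ≡ suc (size (L ∖ v))
  size-∈ {L} = sumOver-∈ L (λ _ → 1)

  size≡0⇒empty : ∀ L → size L ≡ 0 → ∀ i → L i ≡ false
  size≡0⇒empty L size≡0 i with L i in Li
  ... | false = refl
  ... | true with () ← trans (sym size≡0) (trans (sumOver-∖ L i _) (cong (λ b → ⟦ b ⟧ + size (L ∖ i)) Li))

  deg-∖-self : ∀ L v → deg (L ∖ v) v ≡ deg L v
  deg-∖-self L v with L v | sumOver-∖ L v (λ j → ⟦ adj G v j ⟧)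
  ... | true  | deg≡ rewrite irrefl G v = sym deg≡
  ... | false | deg≡ = sym deg≡

  degSum-∈ : ∀ {L v} → L v ≡ true → degSum L ≡ deg L v + (deg L v + degSum (L ∖ v))
  degSum-∈ {L} {v} Lv = begin
    degSum L                                                          ≡⟨ sumOver-∈ L (deg L) Lv ⟩
    deg L v + sumOver (L ∖ v) (deg L)                                 ≡⟨ cong (deg L v +_) (sumOver-cong (λ _ → refl) deg-split) ⟩
    deg L v + sumOver (L ∖ v) (λ i → ⟦ adj G v i ⟧ + deg (L ∖ v) i)  ≡⟨ cong (deg L v +_) (sumOver-+ (L ∖ v) _ _) ⟩
    deg L v + (deg (L ∖ v) v + degSum (L ∖ v))                        ≡⟨ cong (λ d → deg L v + (d + degSum (L ∖ v))) (deg-∖-self L v) ⟩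
    deg L v + (deg L v + degSum (L ∖ v))                              ∎
    where
    open ≡-Reasoning
    deg-split : ∀ i → deg L i ≡ ⟦ adj G v i ⟧ + deg (L ∖ v) i
    deg-split i = trans (sumOver-∈ L (λ j → ⟦ adj G i j ⟧) Lv) (cong (λ b → ⟦ b ⟧ + deg (L ∖ v) i) (Graph.sym G i v))

  potential-∈ : ∀ {L v} → L v ≡ true → potential L ≡ suc (2 * deg L v + potential (L ∖ v))
  potential-∈ {L} {v} Lv =
    trans (cong₂ _+_ (degSum-∈ Lv) (size-∈ Lv)) (rearrange (deg L v) (degSum (L ∖ v)) (size (L ∖ v)))
    where
    rearrange : ∀ d s t → d + (d + s) + suc t ≡ suc (2 * d + (s + t))
    rearrange = solve-∀

  neighbour : ∀ L v → 0 < deg L v → ∃ λ a → L a ≡ true × adj G v a ≡ true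
  neighbour L v 0<deg with a , La , 0<⟦va⟧ ← sumOver-witness L _ 0<deg = a , La , ⟦⟧-positive 0<⟦va⟧
    where
    ⟦⟧-positive : ∀ {b} → 0 < ⟦ b ⟧ → b ≡ true
    ⟦⟧-positive {true} _ = refl

  marked : (Fin n → Bool) → (Fin n → Fin n → Bool) → Fin n → Fin n → Bool
  marked L D v j = L j ∧ (adj G v j ∧ D v j)

  star : (Fin n → Bool) → (Fin n → Fin n → Bool) → Fin n → List (Subset n)
  star L D v = pairWith v (members (marked L D v))

  module _ (L : Fin n → Bool) (D : Fin n → Fin n → Bool) (v : Fin n) where

    flips-star : L v ≡ true → ∀ {j} → L j ≡ true → adj G v j ≡ true → flips (star L D v) v j ≡ D v j
    flips-star Lv {j} Lj vj = begin
      flips (star L D v) v j                ≡⟨ flips-pairWith (members (marked L D v)) v∉marked (adj-irrefl vj ∘ sym) ⟩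
      occursOdd (members (marked L D v)) j  ≡⟨ occursOdd-members (marked L D v) j ⟩
      L j ∧ (adj G v j ∧ D v j)             ≡⟨ cong₂ (λ a b → a ∧ (b ∧ D v j)) Lj vj ⟩
      D v j                                 ∎
      where
      open ≡-Reasoning
      v∉marked : All (v ≢_) (members (marked L D v))
      v∉marked = All.map (λ {x} mx → adj-irrefl (∧-conicalˡ _ _ (∧-conicalʳ (L x) _ mx))) (members-sound (marked L D v))

    star-outside : L v ≡ true → ∀ {i} j → L i ≡ false → flips (star L D v) i j ≡ false
    star-outside Lv j Li =
      flips-outside j (pairWith-outside (∉L Lv) (All.map (∉L ∘ ∧-conicalˡ _ _) (members-sound (marked L D v))))
      where
      ∉L : ∀ {x} → L x ≡ true → _ ≢ x
      ∉L Lx refl with () ← trans (sym Li) Lx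

    length-star : length (star L D v) ≤ ⌈ deg L v /2⌉
    length-star = begin
      length (star L D v)                     ≡⟨ length-pairWith v (members (marked L D v)) ⟩
      ⌈ length (members (marked L D v)) /2⌉  ≤⟨ ⌈n/2⌉-mono (≤-trans (≤-reflexive (length-members (marked L D v))) (sum-mono-≤ marked≤adj)) ⟩
      ⌈ deg L v /2⌉                           ∎
      where
      open ≤-Reasoning
      marked≤adj : ∀ j → ⟦ marked L D v j ⟧ ≤ (if L j then ⟦ adj G v j ⟧ else 0)
      marked≤adj j with L j | adj G v j | D v j
      ... | true  | true  | true  = ≤-refl
      ... | true  | true  | false = z≤n
      ... | true  | false | _     = z≤n
      ... | false | _     | _     = z≤n

    star-cost : 4 * length (star L D v) ≤ 2 * deg L v + 2
    star-cost = ≤-trans (*-monoʳ-≤ 4 length-star) (4⌈n/2⌉≤2n+2 (deg L v))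

    star-cost-even : ∀ h → deg L v ≡ h + h → 4 * length (star L D v) ≤ 2 * deg L v
    star-cost-even h d≡h+h = begin
      4 * length (star L D v)  ≤⟨ *-monoʳ-≤ 4 length-star ⟩
      4 * ⌈ deg L v /2⌉        ≡⟨ cong (λ d → 4 * ⌈ d /2⌉) d≡h+h ⟩
      4 * ⌈ h + h /2⌉          ≡⟨ 4⌈n+n/2⌉≡2[n+n] h ⟩
      2 * (h + h)              ≡⟨ cong (2 *_) d≡h+h ⟨
      2 * deg L v              ∎
      where open ≤-Reasoning

  Symmetricᵇ : (Fin n → Fin n → Bool) → Set
  Symmetricᵇ D = ∀ i j → D i j ≡ D j i

  -- Inversions for G[L] avoid the vertices outside L, whose edges are already settled.
  record Solves (L : Fin n → Bool) (D : Fin n → Fin n → Bool) (Xs : List (Subset n)) : Set where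
    field
      realises : ∀ {i j} → L i ≡ true → L j ≡ true → adj G i j ≡ true → flips Xs i j ≡ D i j
      inside   : ∀ {i} j → L i ≡ false → flips Xs i j ≡ false
      small    : All (λ X → ∣ X ∣ ≤ 3) Xs
  open Solves

  residual : (Fin n → Fin n → Bool) → List (Subset n) → Fin n → Fin n → Bool
  residual D Xs i j = D i j xor flips Xs i j

  residual-sym : ∀ {D} Xs → Symmetricᵇ D → Symmetricᵇ (residual D Xs)
  residual-sym Xs D-sym i j = cong₂ _xor_ (D-sym i j) (flips-sym Xs i j)

  solves-[] : ∀ {L D} → (∀ i → L i ≢ true) → Solves L D []
  solves-[] L-empty = record
    { realises = λ Li _ _ → ⊥-elim (L-empty _ Li)
    ; inside   = λ _ _ → refl
    ; small    = []
    }

  solves-star-++ : ∀ {L D v Ys} → Symmetricᵇ D → L v ≡ true →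
                   Solves (L ∖ v) (residual D (star L D v)) Ys → Solves L D (star L D v ++ Ys)
  solves-star-++ {L} {D} {v} {Ys} D-sym Lv solvesYs = record
    { realises = realises′
    ; inside   = λ {i} j Li → begin
        flips (S ++ Ys) i j           ≡⟨ flips-++ S Ys i j ⟩
        flips S i j xor flips Ys i j  ≡⟨ cong₂ _xor_ (star-outside L D v Lv j Li) (inside solvesYs j (∖-outside L Li)) ⟩
        false                         ∎
    ; small    = ++⁺ (pairWith-small v _) (small solvesYs)
    }
    where
    open ≡-Reasoning
    S = star L D v

    at-v : ∀ {j} → L j ≡ true → adj G v j ≡ true → flips (S ++ Ys) v j ≡ D v j
    at-v {j} Lj vj = begin
      flips (S ++ Ys) v j           ≡⟨ flips-++ S Ys v j ⟩
      flips S v j xor flips Ys v j  ≡⟨ cong (flips S v j xor_) (inside solvesYs j (∖-removes L v)) ⟩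
      flips S v j xor false         ≡⟨ xor-identityʳ _ ⟩
      flips S v j                   ≡⟨ flips-star L D v Lv Lj vj ⟩
      D v j                         ∎

    realises′ : ∀ {i j} → L i ≡ true → L j ≡ true → adj G i j ≡ true → flips (S ++ Ys) i j ≡ D i j
    realises′ {i} {j} Li Lj ij with i ≟ v | j ≟ v
    ... | yes refl | _        = at-v Lj ij
    ... | no _     | yes refl = begin
      flips (S ++ Ys) i v  ≡⟨ flips-sym (S ++ Ys) i v ⟩
      flips (S ++ Ys) v i  ≡⟨ at-v Li (trans (Graph.sym G v i) ij) ⟩
      D v i                ≡⟨ D-sym v i ⟩
      D i v                ∎
    ... | no i≢v   | no j≢v   = begin
      flips (S ++ Ys) i j                      ≡⟨ flips-++ S Ys i j ⟩
      flips S i j xor flips Ys i j             ≡⟨ cong (flips S i j xor_) (realises solvesYs (∖-keeps L Li i≢v) (∖-keeps L Lj j≢v) ij) ⟩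
      flips S i j xor (D i j xor flips S i j)  ≡⟨ xor-cancel (flips S i j) (D i j) ⟩
      D i j                                    ∎

  Solution : (Fin n → Bool) → (Fin n → Fin n → Bool) → Set
  Solution L D = ∃ λ Xs → Solves L D Xs × 4 * length Xs ≤ potential L

  eliminate-even : ∀ {L D v} h → Symmetricᵇ D → L v ≡ true → deg L v ≡ h + h →
                   Solution (L ∖ v) (residual D (star L D v)) →
                   ∃ λ Xs → Solves L D Xs × 4 * length Xs ≤ 2 * deg L v + potential (L ∖ v)
  eliminate-even {L} {D} {v} h D-sym Lv even (Ys , solvesYs , costYs) =
    star L D v ++ Ys , solves-star-++ D-sym Lv solvesYs , 4*length-++ (star L D v) Ys (star-cost-even L D v h even) costYs

  Solver : ℕ → Set
  Solver k = ∀ L D → size L < k → Symmetricᵇ D → Solution L D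

  solve-even : ∀ {k L D v} h → Solver k → size L < suc k → Symmetricᵇ D →
               L v ≡ true → deg L v ≡ h + h → Solution L D
  solve-even {k} {L} {D} {v} h solver size<1+k D-sym Lv even =
    let Xs , solvesXs , costXs =
          eliminate-even h D-sym Lv even (solver (L ∖ v) _ size∖v<k (residual-sym (star L D v) D-sym))
    in  Xs , solvesXs , ≤-trans costXs (≤-trans (n≤1+n _) (≤-reflexive (sym (potential-∈ Lv))))
    where
    size∖v<k : size (L ∖ v) < k
    size∖v<k = subst (_≤ k) (size-∈ Lv) (s≤s⁻¹ size<1+k)

  -- Eliminating the neighbour a first leaves v with even degree.
  solve-odd : ∀ {k L D v a} h → Solver k → size L < suc k → Symmetricᵇ D →
              L v ≡ true → deg L v ≡ suc (h + h) → L a ≡ true → adj G v a ≡ true → Solution L D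
  solve-odd {k} {L} {D} {v} {a} h solver size<1+k D-sym Lv odd La va =
    let Xs , solvesXs , costXs =
          eliminate-even h D₁-sym Lv₁ even₁ (solver (L₁ ∖ v) _ size₂<k (residual-sym (star L₁ D₁ v) D₁-sym))
    in  star L D a ++ Xs , solves-star-++ D-sym La solvesXs , cost Xs costXs
    where
    L₁ = L ∖ a
    D₁ = residual D (star L D a)
    D₁-sym : Symmetricᵇ D₁
    D₁-sym = residual-sym (star L D a) D-sym
    Lv₁ : L₁ v ≡ true
    Lv₁ = ∖-keeps L Lv (adj-irrefl va)
    even₁ : deg L₁ v ≡ h + h
    even₁ = suc-injective (trans (sym deg-L) odd)
      where
      deg-L : deg L v ≡ suc (deg L₁ v)
      deg-L = trans (sumOver-∖ L a _) (cong₂ (λ b c → (if b then ⟦ c ⟧ else 0) + deg L₁ v) La va)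
    size₂<k : size (L₁ ∖ v) < k
    size₂<k = ≤-trans (n≤1+n _) (subst (_≤ k) (trans (size-∈ La) (cong suc (size-∈ Lv₁))) (s≤s⁻¹ size<1+k))
    cost : ∀ Xs → 4 * length Xs ≤ 2 * deg L₁ v + potential (L₁ ∖ v) → 4 * length (star L D a ++ Xs) ≤ potential L
    cost Xs costXs = begin
      4 * length (star L D a ++ Xs)                                ≤⟨ 4*length-++ (star L D a) Xs (star-cost L D a) costXs ⟩
      (2 * deg L a + 2) + (2 * deg L₁ v + potential (L₁ ∖ v))      ≡⟨ shift (2 * deg L a) (2 * deg L₁ v + potential (L₁ ∖ v)) ⟩
      suc (2 * deg L a + suc (2 * deg L₁ v + potential (L₁ ∖ v)))  ≡⟨ cong (λ p → suc (2 * deg L a + p)) (potential-∈ Lv₁) ⟨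
      suc (2 * deg L a + potential L₁)                             ≡⟨ potential-∈ La ⟨
      potential L                                                  ∎
      where
      open ≤-Reasoning
      shift : ∀ x y → (x + 2) + y ≡ suc (x + suc y)
      shift = solve-∀

  solve : ∀ k → Solver k
  solve zero    L D ()
  solve (suc k) L D size<1+k D-sym with any? (λ v → L v ≟ᵇ true)
  ... | no L-empty = [] , solves-[] (λ i Li → L-empty (i , Li)) , z≤n
  ... | yes (v , Lv) with even-or-odd (deg L v)
  ...   | inj₁ (h , even) = solve-even h (solve k) size<1+k D-sym Lv even
  ...   | inj₂ (h , odd) with a , La , va ← neighbour L v (subst (0 <_) (sym odd) (s≤s z≤n))
    = solve-odd h (solve k) size<1+k D-sym Lv odd La va

  solve-full : ∀ {D} → Symmetricᵇ D → Solution full D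
  solve-full D-sym = solve (suc (size full)) full _ ≤-refl D-sym

-- Connectivity

  crossing-edge : ∀ (S : Fin n → Bool) {u w} → Walk G u w → S u ≡ true → S w ≡ false →
                  ∃ λ x → ∃ λ y → S x ≡ true × S y ≡ false × adj G x y ≡ true
  crossing-edge S here                   Su Sw with () ← trans (sym Su) Sw
  crossing-edge S (step {v = v} uv walk) Su Sw with S v in Sv
  ... | true  = crossing-edge S walk Sv Sw
  ... | false = _ , v , Su , Sv , uv

  module _ {S : Fin n → Bool} {y : Fin n} (Sy : S y ≡ false) where

    add-∖ : ∀ i → (add y S ∖ y) i ≡ S i
    add-∖ i with i ≟ y
    ... | yes refl = sym Sy
    ... | no _     = refl

    size-not-add : size (not ∘ S) ≡ suc (size (not ∘ add y S))
    size-not-add = trans (size-∈ {not ∘ S} (cong not Sy)) (cong suc (size-cong de-Morgan))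
      where
      de-Morgan : ∀ i → ((not ∘ S) ∖ y) i ≡ not (add y S i)
      de-Morgan i with i ≡ᵇ y
      ... | true  = refl
      ... | false = refl

    -- y brings one vertex and, through x, at least one edge.
    add-invariant : ∀ {x} → S x ≡ true → adj G x y ≡ true →
                    2 * size S ≤ degSum S + 2 → 2 * size (add y S) ≤ degSum (add y S) + 2
    add-invariant {x} Sx xy inv = begin
      2 * size S′                                  ≡⟨ cong (2 *_) (trans (size-∈ Sy′) (cong suc (size-cong add-∖))) ⟩
      2 * suc (size S)                             ≡⟨ *-suc 2 (size S) ⟩
      2 + 2 * size S                               ≤⟨ +-monoʳ-≤ 2 inv ⟩
      suc (suc (degSum S)) + 2                     ≤⟨ +-monoˡ-≤ 2 (+-mono-≤ 1≤deg (+-monoˡ-≤ (degSum S) 1≤deg)) ⟩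
      deg S′ y + (deg S′ y + degSum S) + 2         ≡⟨ cong (λ t → deg S′ y + (deg S′ y + t) + 2) (degSum-cong add-∖) ⟨
      deg S′ y + (deg S′ y + degSum (S′ ∖ y)) + 2  ≡⟨ cong (_+ 2) (degSum-∈ Sy′) ⟨
      degSum S′ + 2                                ∎
      where
      open ≤-Reasoning
      S′ = add y S
      Sy′ : S′ y ≡ true
      Sy′ rewrite ≡ᵇ-refl y = refl
      S′x : S′ x ≡ true
      S′x = add-keeps {S = S} y Sx
      yx : adj G y x ≡ true
      yx = trans (Graph.sym G y x) xy
      1≤deg : 1 ≤ deg S′ y
      1≤deg = begin
        1                                                     ≡⟨ cong₂ (λ b c → if b then ⟦ c ⟧ else 0) S′x yx ⟨
        (if S′ x then ⟦ adj G y x ⟧ else 0)                   ≤⟨ m≤m+n _ _ ⟩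
        (if S′ x then ⟦ adj G y x ⟧ else 0) + deg (S′ ∖ x) y  ≡⟨ sumOver-∖ S′ x _ ⟨
        deg S′ y                                              ∎

  connected-size-bound-from : Connected G → Fin n → 2 * size full ≤ degSum full + 2
  connected-size-bound-from connected r = grow _ (_≡ᵇ r) refl (≡ᵇ-refl r) initial
    where
    initial : 2 * size (_≡ᵇ r) ≤ degSum (_≡ᵇ r) + 2
    initial = ≤-trans (≤-reflexive (cong (2 *_) (sum-⟦≡ᵇ⟧ r))) (m≤n+m 2 _)

    grow : ∀ k S → size (not ∘ S) ≡ k → S r ≡ true → 2 * size S ≤ degSum S + 2 → 2 * size full ≤ degSum full + 2
    grow zero S none Sr inv = subst₂ (λ s d → 2 * s ≤ d + 2) (size-cong S-full) (degSum-cong S-full) inv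
      where
      S-full : ∀ i → S i ≡ true
      S-full i = not-injective (size≡0⇒empty (not ∘ S) none i)
    grow (suc k) S missing Sr inv =
      let w , ¬Sw , _          = sumOver-witness (not ∘ S) _ (subst (0 <_) (sym missing) (s≤s z≤n))
          x , y , Sx , Sy , xy = crossing-edge S (connected r w) Sr (not-injective ¬Sw)
      in  grow k (add y S) (suc-injective (trans (sym (size-not-add Sy)) missing)) (add-keeps {S = S} y Sr) (add-invariant Sy Sx xy inv)

connected-size-bound : ∀ {n} (G : Graph n) → Connected G → 2 * size G full ≤ degSum G full + 2
connected-size-bound {zero}  G _         = z≤n
connected-size-bound {suc n} G connected = connected-size-bound-from G connected zero

-- Counting edges

-- edgeCount compares indices by a function local to Defs; unification gives it a name here.
edgeLess : ∀ {n} (G : Graph n) →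
           Σ (Fin n → Fin n → Bool) λ less → edgeCount G ≡ countFin (λ i → countFin (λ j → ⟦ adj G i j ∧ less i j ⟧))
edgeLess G = _ , refl

module _ {n} (G : Graph n) {i j : Fin n} where

  edgeLess-< : toℕ i < toℕ j → proj₁ (edgeLess G) i j ≡ true
  edgeLess-< i<j with toℕ i <? toℕ j
  ... | yes _   = refl
  ... | no  i≮j = ⊥-elim (i≮j i<j)

  edgeLess-≮ : ¬ toℕ i < toℕ j → proj₁ (edgeLess G) i j ≡ false
  edgeLess-≮ i≮j with toℕ i <? toℕ j
  ... | yes i<j = ⊥-elim (i≮j i<j)
  ... | no  _   = refl

degSum-full : ∀ {n} (G : Graph n) → degSum G full ≡ 2 * edgeCount G
degSum-full {n} G = begin
  sum (λ i → sum (λ j → ⟦ adj G i j ⟧))                  ≡⟨ sum-cong-≗ (λ i → trans (sum-cong-≗ (split i)) (∑-distrib-+ (e i) (λ j → e j i))) ⟩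
  sum (λ i → sum (e i) + sum (λ j → e j i))              ≡⟨ ∑-distrib-+ (λ i → sum (e i)) (λ i → sum (λ j → e j i)) ⟩
  sum (λ i → sum (e i)) + sum (λ i → sum (λ j → e j i))  ≡⟨ cong (sum (λ i → sum (e i)) +_) (∑-comm (λ i j → e j i)) ⟩
  sum (λ i → sum (e i)) + sum (λ j → sum (λ i → e j i))  ≡⟨ cong₂ _+_ edgeCount≡ edgeCount≡ ⟨
  edgeCount G + edgeCount G                              ≡⟨ cong (edgeCount G +_) (+-identityʳ (edgeCount G)) ⟨
  2 * edgeCount G                                        ∎
  where
  open ≡-Reasoning
  e : Fin n → Fin n → ℕ
  e i j = ⟦ adj G i j ∧ proj₁ (edgeLess G) i j ⟧
  edgeCount≡ : edgeCount G ≡ sum (λ i → sum (e i))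
  edgeCount≡ = trans (proj₂ (edgeLess G)) (trans (countFin≡sum (λ i → countFin (e i))) (sum-cong-≗ (λ i → countFin≡sum (e i))))
  split : ∀ i j → ⟦ adj G i j ⟧ ≡ e i j + e j i
  split i j with <-cmp (toℕ i) (toℕ j)
  ... | tri< i<j _ _
    rewrite edgeLess-< G i<j | edgeLess-≮ G (<-asym i<j)
          | Graph.sym G j i | ∧-identityʳ (adj G i j) | ∧-zeroʳ (adj G i j) = sym (+-identityʳ _)
  ... | tri> _ _ j<i
    rewrite edgeLess-≮ G (<-asym j<i) | edgeLess-< G j<i
          | Graph.sym G j i | ∧-identityʳ (adj G i j) | ∧-zeroʳ (adj G i j) = refl
  ... | tri≈ _ i≡j _ rewrite toℕ-injective i≡j | irrefl G j = refl

theorem4 : ∀ {n : ℕ} (G : Graph n) → Connected G →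
    InvDiamAtMost 3 G ⌈ 3 * edgeCount G / 4 ⌉
theorem4 G connected O₁ O₂ =
  let Xs , solves , cost = solve-full G (△-sym O₁ O₂)
  in  Xs
    , ≤⌈3m/4⌉ {m = edgeCount G} cost (connected-size-bound G connected) (degSum-full G)
    , Solves.small solves
    , invertAll-△ O₁ O₂ Xs (Solves.realises solves refl refl)
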